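{- Let $K(A,B)$ be a complete bipartite graph whose edges are colored blue and green, and suppose $K(A,B)$ is an $S_2$-type graph. Then the vertices of $K(A,B)$ can be covered either by an isolated vertex together with one monochromatic tree, or by two vertex-disjoint monochromatic trees of different colors. Furthermore, if $X\cup Y\subseteq A$ (respectively $X\cup Y\subseteq B$) and $\min\{|X|,|Y|\}\neq 1$, then the vertices of $K(A,B)$ can be covered by two vertex-disjoint monochromatic trees of different colors.
   Context: $K(A,B)$ is the complete bipartite graph with nonempty partite sets $A,B$, edges colored blue or green. A monochromatic tree is a tree all of whose edges have the same color; a single vertex counts as one. Let $X$ be the set of vertices all of whose incident edges are blue and $Y$ the set of vertices all of whose incident edges are green. $K(A,B)$ is $S$-type if $X\neq\emptyset$ and $Y\neq\emptyset$; then $X\cup Y$ lies within a single partite set. If $X\cup Y\subseteq A$, write $A_1=X$, $A_3=Y$, $A_2=A\setminus(A_1\cup A_3)$, and for each nonempty proper subset $B'\subsetneq B$ let $b(B')$ be the set of $x\in A_2$ such that all edges from $x$ to $B'$ are blue and all edges from $x$ to $B\setminus B'$ are green. $K(A,B)$ (with $X\cup Y\subseteq A$) is $S_1^*$-type if it is $S$-type, $|B|=1$, $|A_1|\geq 2$ and $|A_3|\geq 2$; it is $S_1'$-type if it is $S$-type, $|B|\geq 2$, $|A_1|\geq 2$, $|A_3|\geq 2$, and $b(B')\neq\emptyset$ for every nonempty proper subset $B'$ of $B$. The analogous definitions apply with the roles of $A$ and $B$ exchanged when $X\cup Y\subseteq B$. $K(A,B)$ is $S_1$-type if it is $S_1^*$-type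 or $S_1'$-type, and $S_2$-type if it is $S$-type but not $S_1$-type. -}

module Defs where

open import Data.Nat using (ℕ; zero; suc; _≤_; _⊓_; _<_)
open import Data.Fin using (Fin)
open import Data.Fin.Properties using (all?)
open import Data.Fin.Subset using (Subset; _∈_; _∉_; Nonempty; ⊤)
open import Data.List using (List; []; _∷_; length; filter; allFin)
open import Data.Sum using (_⊎_; inj₁; inj₂)
open import Data.Product using (_×_; _,_; ∃; ∃-syntax; Σ-syntax)
open import Data.Empty using (⊥)
open import Function using (flip)
open import Relation.Nullary using (¬_; Dec; yes; no)
open import Relation.Binary.PropositionalEquality using (_≡_; _≢_; refl)
import Data.List.Membership.Propositional as LM

data Color : Set where
  blue green : Color

_≟c_ : (x y : Color) → Dec (x ≡ y)
blue  ≟c blue  = yes refl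
blue  ≟c green = no λ ()
green ≟c blue  = no λ ()
green ≟c green = yes refl

-- A colouring of K(A,B) with A = Fin m, B = Fin n: c a b is the colour of edge ab.
Coloring : ℕ → ℕ → Set
Coloring m n = Fin m → Fin n → Color

-- Vertices of K(A,B): inj₁ a for a ∈ A, inj₂ b for b ∈ B.
Vertex : ℕ → ℕ → Set
Vertex m n = Fin m ⊎ Fin n

module _ {m n : ℕ} (c : Coloring m n) where

  Adj : Color → Vertex m n → Vertex m n → Set
  Adj col (inj₁ a) (inj₂ b) = c a b ≡ col
  Adj col (inj₂ b) (inj₁ a) = c a b ≡ col
  Adj col (inj₁ _) (inj₁ _) = ⊥
  Adj col (inj₂ _) (inj₂ _) = ⊥

  -- MonoTree col vs : there is a tree all of whose edges have colour col,
  -- whose vertex set is exactly the (duplicate-free) list vs.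
  -- Trees are generated by: a single vertex, and adding a new leaf.
  data MonoTree (col : Color) : List (Vertex m n) → Set where
    single : (v : Vertex m n) → MonoTree col (v ∷ [])
    addLeaf : ∀ {vs} {u v : Vertex m n} → MonoTree col vs →
              u LM.∈ vs → ¬ (v LM.∈ vs) → Adj col u v → MonoTree col (v ∷ vs)

  CoverIsoTree : Set
  CoverIsoTree = ∃[ v ] ∃[ col ] ∃[ vs ]
    (MonoTree col vs × ¬ (v LM.∈ vs) × (∀ w → w ≢ v → w LM.∈ vs))

  CoverTwo : Set
  CoverTwo = ∃[ col₁ ] ∃[ col₂ ] ∃[ vs₁ ] ∃[ vs₂ ]
    (col₁ ≢ col₂ × MonoTree col₁ vs₁ × MonoTree col₂ vs₂ ×
     (∀ w → w LM.∈ vs₁ → ¬ (w LM.∈ vs₂)) ×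
     (∀ w → w LM.∈ vs₁ ⊎ w LM.∈ vs₂))

  AllColA : Color → Fin m → Set
  AllColA col a = ∀ b → c a b ≡ col
  AllColB : Color → Fin n → Set
  AllColB col b = ∀ a → c a b ≡ col

  AllCol : Color → Vertex m n → Set
  AllCol col (inj₁ a) = AllColA col a
  AllCol col (inj₂ b) = AllColB col b

  -- X = AllCol blue, Y = AllCol green
  allColA? : ∀ col a → Dec (AllColA col a)
  allColA? col a = all? (λ b → c a b ≟c col)
  allColB? : ∀ col b → Dec (AllColB col b)
  allColB? col b = all? (λ a → c a b ≟c col)

  cardA : Color → ℕ
  cardA col = length (filter (allColA? col) (allFin m))
  cardB : Color → ℕ
  cardB col = length (filter (allColB? col) (allFin n))
  card : Color → ℕ
  card col = cardA col Data.Nat.+ cardB col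

  cardX cardY : ℕ
  cardX = card blue
  cardY = card green

  STyp : Set
  STyp = (∃[ v ] AllCol blue v) × (∃[ v ] AllCol green v)

  XYinA : Set
  XYinA = ∀ b → ¬ AllColB blue b × ¬ AllColB green b

  -- b(B') is nonempty: some x ∈ A₂ is blue exactly towards B'
  bNonempty : Subset n → Set
  bNonempty B' = ∃[ x ] (¬ AllColA blue x × ¬ AllColA green x ×
                   (∀ y → (y ∈ B' → c x y ≡ blue) × (y ∉ B' → c x y ≡ green)))

  -- S₁*-type with X ∪ Y ⊆ A (S-typeness added separately)
  S1starA : Set
  S1starA = XYinA × n ≡ 1 × 2 ≤ cardA blue × 2 ≤ cardA green

  S1primeA : Set
  S1primeA = XYinA × 2 ≤ n × 2 ≤ cardA blue × 2 ≤ cardA green ×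
             (∀ (B' : Subset n) → Nonempty B' → B' ≢ ⊤ → bNonempty B')

open Data.Nat using (_+_)

XYinB : ∀ {m n} → Coloring m n → Set
XYinB c = XYinA (flip c)

S1star S1prime S1 S2 : ∀ {m n} → Coloring m n → Set
S1star c = STyp c × (S1starA c ⊎ S1starA (flip c))
S1prime c = STyp c × (S1primeA c ⊎ S1primeA (flip c))
S1 c = S1star c ⊎ S1prime c
S2 c = STyp c × ¬ S1 c

module Submission where

-- An S₂-type colouring of K(A,B) can always be covered by two vertex-disjoint
-- monochromatic trees of different colours; since such a cover is in particular
-- one of the two alternatives of the first claim, both claims follow.
--
-- Say X ∪ Y ⊆ A (the other case follows by transposing the colouring), and fix
-- a₁ ∈ X and a₃ ∈ Y.  The cover comes from a 2-colouring ("side") of the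
-- vertices: a set B' ⊆ B goes to the blue side together with a₁, ∁B' goes to the
-- green side together with a₃, and every other a ∈ A joins a side in which it
-- has a neighbour of that side's colour.  Each side then spans a tree of its
-- colour: a₁ (resp. a₃) is joined to all of B' (resp. ∁B'), and the remaining
-- A-vertices hang off these as leaves.  A suitable B' exists because the
-- colouring is not S₁-type: if |A₁| = 1 take B' = ∅, if |A₃| = 1 take B' = B,
-- and otherwise (|B| ≥ 2 as it is not S₁*) some nonempty proper B'' has
-- b(B'') = ∅, and B' = ∁B'' works.

open import Defs
open import Data.Nat using (ℕ; zero; suc; _<_; _⊓_; _≤_; s≤s; z≤n)
open import Data.Product using (_×_; _,_; ∃-syntax; proj₂)
open import Data.Sum using (_⊎_; inj₁; inj₂; [_,_]; swap)
import Data.Sum as Sum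
open import Data.Sum.Properties using (inj₁-injective; inj₂-injective; swap-involutive)
open import Data.Empty using (⊥-elim)
open import Data.Fin using (Fin; fromℕ<) renaming (_≟_ to _≟f_)
open import Data.Fin.Properties using (any?; all?; ¬∀⟶∃¬)
open import Data.Fin.Subset as Subset using (Subset; Nonempty; ∁)
open import Data.Fin.Subset.Properties
  using (_∈?_; ∉⊥; ∈⊤; ⊆⊤; ⊆-antisym; x∈p⇒x∉∁p; x∉p⇒x∈∁p; nonempty?; anySubset?)
open import Data.List using (List; []; _∷_; _++_; map; filter; allFin; length)
open import Data.List.Membership.Propositional using (_∈_; _∉_)
open import Data.List.Membership.Propositional.Properties
  using (∈-map⁺; ∈-map⁻; ∈-filter⁺; ∈-filter⁻; ∈-allFin; ∈-++⁺ˡ; ∈-++⁺ʳ; ∈-++⁻)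
open import Data.List.Relation.Unary.Any using (here; there)
open import Data.List.Relation.Unary.AllPairs using (tail)
open import Data.List.Relation.Unary.Unique.Propositional using (Unique)
import Data.List.Relation.Unary.Unique.Propositional.Properties as Unique
open import Data.Vec.Properties using () renaming (≡-dec to ≡-decVec)
open import Data.Bool.Properties using () renaming (_≟_ to _≟b_)
open import Function using (_∘_; flip)
open import Relation.Binary.PropositionalEquality using (_≡_; _≢_; refl; sym; trans; subst)
open import Relation.Nullary using (¬_; yes; no)
open import Relation.Nullary.Decidable using (_×-dec_; _→-dec_; ¬?)
open import Relation.Unary using (Pred; Decidable)
open import Level using (0ℓ)

blue≢green : blue ≢ green
blue≢green ()

≢blue⇒green : ∀ {col} → col ≢ blue → col ≡ green
≢blue⇒green {blue}  ne = ⊥-elim (ne refl)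
≢blue⇒green {green} _  = refl

≢green⇒blue : ∀ {col} → col ≢ green → col ≡ blue
≢green⇒blue {blue}  _  = refl
≢green⇒blue {green} ne = ⊥-elim (ne refl)

module _ {A B : Set} (f : A → B) {Q : Pred A 0ℓ} (Q? : Decidable Q) where

  ∈-mapFilter⁺ : ∀ {xs x} → x ∈ xs → Q x → f x ∈ map f (filter Q? xs)
  ∈-mapFilter⁺ x∈ qx = ∈-map⁺ f (∈-filter⁺ Q? x∈ qx)

  ∈-mapFilter⁻ : ∀ xs {y} → y ∈ map f (filter Q? xs) → ∃[ x ] (Q x × y ≡ f x)
  ∈-mapFilter⁻ xs y∈ with ∈-map⁻ f y∈
  ... | x , x∈ , refl = x , proj₂ (∈-filter⁻ Q? {xs = xs} x∈) , refl

distinct⇒2≤length : ∀ {A : Set} {x y : A} (xs : List A) → x ∈ xs → y ∈ xs → x ≢ y → 2 ≤ length xs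
distinct⇒2≤length (_ ∷ [])     (here refl) (here refl) x≢y = ⊥-elim (x≢y refl)
distinct⇒2≤length (_ ∷ _ ∷ _)  _           _           _   = s≤s (s≤s z≤n)

≢1⇒2≤ : ∀ {k} → Fin k → k ≢ 1 → 2 ≤ k
≢1⇒2≤ {suc zero}     _ k≢1 = ⊥-elim (k≢1 refl)
≢1⇒2≤ {suc (suc _)} _ _   = s≤s (s≤s z≤n)

≢⊤⇒∃∉ : ∀ {k} (p : Subset k) → p ≢ Subset.⊤ → ∃[ x ] (x Subset.∉ p)
≢⊤⇒∃∉ {k} p p≢⊤ =
  ¬∀⟶∃¬ k (Subset._∈ p) (_∈? p) (λ all∈ → p≢⊤ (⊆-antisym ⊆⊤ (λ {x} _ → all∈ x)))

module Covering {m n : ℕ} (c : Coloring m n) where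

  V : Set
  V = Vertex m n

  SpanningTree : Color → Pred V 0ℓ → Set
  SpanningTree col P =
    ∃[ vs ] (MonoTree c col vs × (∀ {w} → w ∈ vs → P w) × (∀ w → P w → w ∈ vs))

  growTree : ∀ {col vs} → MonoTree c col vs → (ws : List V) → Unique ws →
    (∀ {w} → w ∈ ws → w ∉ vs) → (∀ {w} → w ∈ ws → ∃[ u ] (u ∈ vs × Adj c col u w)) →
    MonoTree c col (ws ++ vs)
  growTree t []       _  _     _     = t
  growTree t (w ∷ ws) uq fresh nbrOf with nbrOf (here refl)
  ... | u , u∈ , adj = addLeaf (growTree t ws (tail uq) (fresh ∘ there) (nbrOf ∘ there))
                         (∈-++⁺ʳ ws u∈) w∉ adj
    where
    w∉ : w ∉ ws ++ _
    w∉ w∈ with ∈-++⁻ ws w∈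
    ... | inj₁ inWs = Unique.Unique[x∷xs]⇒x∉xs uq inWs
    ... | inj₂ inVs = fresh (here refl) inVs

  Rooted : Color → Pred V 0ℓ → Fin m → Set
  Rooted col P r = P (inj₁ r) × (∀ b → P (inj₂ b) → c r b ≡ col) ×
    (∀ a → P (inj₁ a) → a ≢ r → ∃[ b ] (P (inj₂ b) × c a b ≡ col))

  -- A rooted class spans a tree of its colour: the root, then its B-vertices
  -- as leaves of the root, then its other A-vertices as leaves of those.
  rootedTree : ∀ {col P r} → Decidable P → Rooted col P r → SpanningTree col P
  rootedTree {col} {P} {r} P? (Pr , rootAdj , hasNbr) =
    aLayer ++ (bLayer ++ root) , tree , sound , complete
    where
    InB : Pred (Fin n) 0ℓ
    InB b = P (inj₂ b)
    InB? : Decidable InB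
    InB? b = P? (inj₂ b)
    InA : Pred (Fin m) 0ℓ
    InA a = P (inj₁ a) × a ≢ r
    InA? : Decidable InA
    InA? a = P? (inj₁ a) ×-dec ¬? (a ≟f r)

    root bLayer aLayer : List V
    root   = inj₁ r ∷ []
    bLayer = map inj₂ (filter InB? (allFin n))
    aLayer = map inj₁ (filter InA? (allFin m))

    tree : MonoTree c col (aLayer ++ (bLayer ++ root))
    tree = growTree (growTree (single (inj₁ r)) bLayer
                      (Unique.map⁺ inj₂-injective (Unique.filter⁺ InB? (Unique.allFin⁺ n)))
                      bFresh bNbr)
                    aLayer
                    (Unique.map⁺ inj₁-injective (Unique.filter⁺ InA? (Unique.allFin⁺ m)))
                    aFresh aNbr
      where
      bFresh : ∀ {w} → w ∈ bLayer → w ∉ root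
      bFresh w∈ (here refl) with ∈-mapFilter⁻ inj₂ InB? (allFin n) w∈
      ... | _ , _ , ()
      bNbr : ∀ {w} → w ∈ bLayer → ∃[ u ] (u ∈ root × Adj c col u w)
      bNbr w∈ with ∈-mapFilter⁻ inj₂ InB? (allFin n) w∈
      ... | b , Pb , refl = inj₁ r , here refl , rootAdj b Pb
      aFresh : ∀ {w} → w ∈ aLayer → w ∉ bLayer ++ root
      aFresh w∈ w∈' with ∈-mapFilter⁻ inj₁ InA? (allFin m) w∈ | ∈-++⁻ bLayer w∈'
      ... | a , _ , refl | inj₁ inB with ∈-mapFilter⁻ inj₂ InB? (allFin n) inB
      ...   | _ , _ , ()
      aFresh w∈ w∈' | a , (_ , a≢r) , refl | inj₂ (here eq) = a≢r (inj₁-injective eq)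
      aNbr : ∀ {w} → w ∈ aLayer → ∃[ u ] (u ∈ bLayer ++ root × Adj c col u w)
      aNbr w∈ with ∈-mapFilter⁻ inj₁ InA? (allFin m) w∈
      ... | a , (Pa , a≢r) , refl with hasNbr a Pa a≢r
      ...   | b , Pb , ab = inj₂ b , ∈-++⁺ˡ (∈-mapFilter⁺ inj₂ InB? (∈-allFin b) Pb) , ab

    sound : ∀ {w} → w ∈ aLayer ++ (bLayer ++ root) → P w
    sound w∈ with ∈-++⁻ aLayer w∈
    ... | inj₁ inA with ∈-mapFilter⁻ inj₁ InA? (allFin m) inA
    ...   | _ , (Pa , _) , refl = Pa
    sound w∈ | inj₂ w∈' with ∈-++⁻ bLayer w∈'
    ... | inj₁ inB with ∈-mapFilter⁻ inj₂ InB? (allFin n) inB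
    ...   | _ , Pb , refl = Pb
    sound w∈ | inj₂ w∈' | inj₂ (here refl) = Pr

    complete : ∀ w → P w → w ∈ aLayer ++ (bLayer ++ root)
    complete (inj₂ b) Pb = ∈-++⁺ʳ aLayer (∈-++⁺ˡ (∈-mapFilter⁺ inj₂ InB? (∈-allFin b) Pb))
    complete (inj₁ a) Pa with a ≟f r
    ... | yes refl = ∈-++⁺ʳ aLayer (∈-++⁺ʳ bLayer (here refl))
    ... | no a≢r   = ∈-++⁺ˡ (∈-mapFilter⁺ inj₁ InA? (∈-allFin a) (Pa , a≢r))

  coverFromSides : (side : V → Color) {a₁ a₃ : Fin m} →
    Rooted blue (λ w → side w ≡ blue) a₁ → Rooted green (λ w → side w ≡ green) a₃ →
    CoverTwo c
  coverFromSides side blueClass greenClass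
    with rootedTree (λ w → side w ≟c blue) blueClass | rootedTree (λ w → side w ≟c green) greenClass
  ... | blueVs , blueTree , blueSound , blueComplete | greenVs , greenTree , greenSound , greenComplete =
    blue , green , blueVs , greenVs , blue≢green , blueTree , greenTree , disjoint , covers
    where
    disjoint : ∀ w → w ∈ blueVs → w ∉ greenVs
    disjoint w inBlue inGreen = blue≢green (trans (sym (blueSound inBlue)) (greenSound inGreen))

    covers : ∀ w → w ∈ blueVs ⊎ w ∈ greenVs
    covers w with side w in eq
    ... | blue  = inj₁ (blueComplete w eq)
    ... | green = inj₂ (greenComplete w eq)

  EdgeIntoSide : Subset n → Fin m → Set
  EdgeIntoSide B' a =
    (∃[ b ] (b Subset.∈ B' × c a b ≡ blue)) ⊎ (∃[ b ] (b Subset.∉ B' × c a b ≡ green))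

  partitionCover : ∀ {a₁ a₃} → a₁ ≢ a₃ → AllColA c blue a₁ → AllColA c green a₃ →
    (B' : Subset n) → (∀ a → a ≢ a₁ → a ≢ a₃ → EdgeIntoSide B' a) → CoverTwo c
  partitionCover {a₁} {a₃} a₁≢a₃ h₁ h₃ B' choice =
    coverFromSides side (side-a₁ , (λ b _ → h₁ b) , blueNbr) (side-a₃ , (λ b _ → h₃ b) , greenNbr)
    where
    side : V → Color
    side (inj₁ a) with a ≟f a₁ | a ≟f a₃
    ... | yes _   | _       = blue
    ... | no _    | yes _   = green
    ... | no a≢a₁ | no a≢a₃ = [ (λ _ → blue) , (λ _ → green) ] (choice a a≢a₁ a≢a₃)
    side (inj₂ b) with b ∈? B'
    ... | yes _ = blue
    ... | no _  = green

    side-a₁ : side (inj₁ a₁) ≡ blue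
    side-a₁ with a₁ ≟f a₁
    ... | yes _   = refl
    ... | no a≢a₁ = ⊥-elim (a≢a₁ refl)

    side-a₃ : side (inj₁ a₃) ≡ green
    side-a₃ with a₃ ≟f a₁ | a₃ ≟f a₃
    ... | yes a₃≡a₁ | _       = ⊥-elim (a₁≢a₃ (sym a₃≡a₁))
    ... | no _      | yes _   = refl
    ... | no _      | no a≢a₃ = ⊥-elim (a≢a₃ refl)

    side-∈ : ∀ {b} → b Subset.∈ B' → side (inj₂ b) ≡ blue
    side-∈ {b} b∈ with b ∈? B'
    ... | yes _ = refl
    ... | no b∉ = ⊥-elim (b∉ b∈)

    side-∉ : ∀ {b} → b Subset.∉ B' → side (inj₂ b) ≡ green
    side-∉ {b} b∉ with b ∈? B'
    ... | yes b∈ = ⊥-elim (b∉ b∈)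
    ... | no _   = refl

    blueNbr : ∀ a → side (inj₁ a) ≡ blue → a ≢ a₁ → ∃[ b ] (side (inj₂ b) ≡ blue × c a b ≡ blue)
    blueNbr a isBlue a≢a₁ with a ≟f a₁ | a ≟f a₃
    ... | yes a≡a₁ | _       = ⊥-elim (a≢a₁ a≡a₁)
    ... | no _     | yes _   = ⊥-elim (blue≢green (sym isBlue))
    ... | no a≢a₁' | no a≢a₃ with choice a a≢a₁' a≢a₃
    ...   | inj₁ (b , b∈ , ab) = b , side-∈ b∈ , ab
    ...   | inj₂ _             = ⊥-elim (blue≢green (sym isBlue))

    greenNbr : ∀ a → side (inj₁ a) ≡ green → a ≢ a₃ → ∃[ b ] (side (inj₂ b) ≡ green × c a b ≡ green)
    greenNbr a isGreen a≢a₃ with a ≟f a₁ | a ≟f a₃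
    ... | yes _ | _        = ⊥-elim (blue≢green isGreen)
    ... | no _  | yes a≡a₃ = ⊥-elim (a≢a₃ a≡a₃)
    ... | no a≢a₁ | no a≢a₃' with choice a a≢a₁ a≢a₃'
    ...   | inj₁ _             = ⊥-elim (blue≢green isGreen)
    ...   | inj₂ (b , b∉ , ab) = b , side-∉ b∉ , ab

  ¬X⇒greenEdge : ∀ a → ¬ AllColA c blue a → ∃[ b ] (c a b ≡ green)
  ¬X⇒greenEdge a a∉X with ¬∀⟶∃¬ n (λ b → c a b ≡ blue) (λ b → c a b ≟c blue) a∉X
  ... | b , ab≢blue = b , ≢blue⇒green ab≢blue

  ¬Y⇒blueEdge : ∀ a → ¬ AllColA c green a → ∃[ b ] (c a b ≡ blue)
  ¬Y⇒blueEdge a a∉Y with ¬∀⟶∃¬ n (λ b → c a b ≡ green) (λ b → c a b ≟c green) a∉Y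
  ... | b , ab≢green = b , ≢green⇒blue ab≢green

  coverIfUniqueBlue : ∀ {a₁ a₃} → a₁ ≢ a₃ → AllColA c blue a₁ → AllColA c green a₃ →
    (∀ a → a ≢ a₁ → ¬ AllColA c blue a) → CoverTwo c
  coverIfUniqueBlue {a₁} {a₃} a₁≢a₃ h₁ h₃ uniqueBlue = partitionCover a₁≢a₃ h₁ h₃ Subset.⊥ edge
    where
    edge : ∀ a → a ≢ a₁ → a ≢ a₃ → EdgeIntoSide Subset.⊥ a
    edge a a≢a₁ _ with ¬X⇒greenEdge a (uniqueBlue a a≢a₁)
    ... | b , ab = inj₂ (b , ∉⊥ , ab)

  coverIfUniqueGreen : ∀ {a₁ a₃} → a₁ ≢ a₃ → AllColA c blue a₁ → AllColA c green a₃ →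
    (∀ a → a ≢ a₃ → ¬ AllColA c green a) → CoverTwo c
  coverIfUniqueGreen {a₁} {a₃} a₁≢a₃ h₁ h₃ uniqueGreen = partitionCover a₁≢a₃ h₁ h₃ Subset.⊤ edge
    where
    edge : ∀ a → a ≢ a₁ → a ≢ a₃ → EdgeIntoSide Subset.⊤ a
    edge a _ a≢a₃ with ¬Y⇒blueEdge a (uniqueGreen a a≢a₃)
    ... | b , ab = inj₁ (b , ∈⊤ , ab)

  emptyB⇒edgeIntoSide : (B'' : Subset n) → Nonempty B'' → B'' ≢ Subset.⊤ →
    ¬ bNonempty c B'' → ∀ a → EdgeIntoSide (∁ B'') a
  emptyB⇒edgeIntoSide B'' (b₁ , b₁∈) B''≢⊤ noB a
    with any? (λ b → (b ∈? ∁ B'') ×-dec (c a b ≟c blue))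
       | any? (λ b → ¬? (b ∈? ∁ B'') ×-dec (c a b ≟c green))
  ... | yes blueEdge | _          = inj₁ blueEdge
  ... | no _         | yes greenEdge = inj₂ greenEdge
  ... | no noBlue    | no noGreen = ⊥-elim (noB (a , a∉X , a∉Y , λ b → blueOn b , greenOff b))
    where
    blueOn : ∀ b → b Subset.∈ B'' → c a b ≡ blue
    blueOn b b∈ = ≢green⇒blue (λ ab → noGreen (b , x∈p⇒x∉∁p b∈ , ab))
    greenOff : ∀ b → b Subset.∉ B'' → c a b ≡ green
    greenOff b b∉ = ≢blue⇒green (λ ab → noBlue (b , x∉p⇒x∈∁p b∉ , ab))
    a∉X : ¬ AllColA c blue a
    a∉X allBlue with ≢⊤⇒∃∉ B'' B''≢⊤
    ... | b , b∉ = blue≢green (trans (sym (allBlue b)) (greenOff b b∉))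
    a∉Y : ¬ AllColA c green a
    a∉Y allGreen = blue≢green (trans (sym (blueOn b₁ b₁∈)) (allGreen b₁))

  -- b(B') is decidable, so a failure of the S₁' condition has a witness B''.
  bNonempty? : Decidable (bNonempty c)
  bNonempty? B' = any? λ a → ¬? (allColA? c blue a) ×-dec ¬? (allColA? c green a) ×-dec
    all? (λ b → ((b ∈? B') →-dec (c a b ≟c blue)) ×-dec (¬? (b ∈? B') →-dec (c a b ≟c green)))

  missingSubset : ¬ (∀ B' → Nonempty B' → B' ≢ Subset.⊤ → bNonempty c B') →
    ∃[ B'' ] (Nonempty B'' × B'' ≢ Subset.⊤ × ¬ bNonempty c B'')
  missingSubset notAll
    with anySubset? (λ B' → nonempty? B' ×-dec ¬? (≡-decVec _≟b_ B' Subset.⊤) ×-dec ¬? (bNonempty? B'))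
  ... | yes witness = witness
  ... | no none = ⊥-elim (notAll present)
    where
    present : ∀ B' → Nonempty B' → B' ≢ Subset.⊤ → bNonempty c B'
    present B' ne B'≢⊤ with bNonempty? B'
    ... | yes found = found
    ... | no missing = ⊥-elim (none (B' , ne , B'≢⊤ , missing))

  2≤cardA : ∀ col {a a'} → a ≢ a' → AllColA c col a → AllColA c col a' → 2 ≤ cardA c col
  2≤cardA col {a} {a'} a≢a' ha ha' = distinct⇒2≤length (filter (allColA? c col) (allFin m))
    (∈-filter⁺ (allColA? c col) (∈-allFin a) ha) (∈-filter⁺ (allColA? c col) (∈-allFin a') ha') a≢a'

  X≢Y : Fin n → ∀ {a₁ a₃} → AllColA c blue a₁ → AllColA c green a₃ → a₁ ≢ a₃
  X≢Y b₀ h₁ h₃ refl = blue≢green (trans (sym (h₁ b₀)) (h₃ b₀))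

  coverA : Fin n → ∀ {a₁ a₃} → AllColA c blue a₁ → AllColA c green a₃ →
    ¬ S1starA c → ¬ S1primeA c → CoverTwo c
  coverA b₀ {a₁} {a₃} h₁ h₃ ¬S1* ¬S1'
    with any? (λ a → ¬? (a ≟f a₁) ×-dec allColA? c blue a)
       | any? (λ a → ¬? (a ≟f a₃) ×-dec allColA? c green a)
  ... | no noSecondBlue | _ =
    coverIfUniqueBlue (X≢Y b₀ h₁ h₃) h₁ h₃ (λ a a≢a₁ allBlue → noSecondBlue (a , a≢a₁ , allBlue))
  ... | yes _ | no noSecondGreen =
    coverIfUniqueGreen (X≢Y b₀ h₁ h₃) h₁ h₃ (λ a a≢a₃ allGreen → noSecondGreen (a , a≢a₃ , allGreen))
  ... | yes (a₁' , a₁'≢a₁ , h₁') | yes (a₃' , a₃'≢a₃ , h₃')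
    with missingSubset (λ allPresent → ¬S1' (XY , 2≤n , 2≤A₁ , 2≤A₃ , allPresent))
    where
    XY : XYinA c
    XY b = (λ allBlue → blue≢green (trans (sym (allBlue a₃)) (h₃ b)))
         , (λ allGreen → blue≢green (trans (sym (h₁ b)) (allGreen a₁)))
    2≤A₁ : 2 ≤ cardA c blue
    2≤A₁ = 2≤cardA blue (a₁'≢a₁ ∘ sym) h₁ h₁'
    2≤A₃ : 2 ≤ cardA c green
    2≤A₃ = 2≤cardA green (a₃'≢a₃ ∘ sym) h₃ h₃'
    2≤n : 2 ≤ n
    2≤n = ≢1⇒2≤ b₀ (λ n≡1 → ¬S1* (XY , n≡1 , 2≤A₁ , 2≤A₃))
  ... | B'' , ne , B''≢⊤ , noB =
    partitionCover (X≢Y b₀ h₁ h₃) h₁ h₃ (∁ B'') (λ a _ _ → emptyB⇒edgeIntoSide B'' ne B''≢⊤ noB a)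

module Transpose {m n : ℕ} (c : Coloring m n) where

  ∈-swap⁻ : ∀ {w : Vertex m n} {vs : List (Vertex n m)} → w ∈ map swap vs → swap w ∈ vs
  ∈-swap⁻ w∈ with ∈-map⁻ swap w∈
  ... | v , v∈ , refl = subst (_∈ _) (sym (swap-involutive v)) v∈

  ∈-swap⁺ : ∀ {w : Vertex m n} {vs : List (Vertex n m)} → swap w ∈ vs → w ∈ map swap vs
  ∈-swap⁺ {w} {vs} w∈ = subst (_∈ map swap vs) (swap-involutive w) (∈-map⁺ swap w∈)

  adj-swap : ∀ {col} (u v : Vertex n m) → Adj (flip c) col u v → Adj c col (swap u) (swap v)
  adj-swap (inj₁ _) (inj₂ _) uv = uv
  adj-swap (inj₂ _) (inj₁ _) uv = uv

  tree-swap : ∀ {col vs} → MonoTree (flip c) col vs → MonoTree c col (map swap vs)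
  tree-swap (single v) = single (swap v)
  tree-swap (addLeaf {vs} {u} {v} t u∈ v∉ uv) =
    addLeaf (tree-swap t) (∈-map⁺ swap u∈)
      (λ v∈ → v∉ (subst (_∈ vs) (swap-involutive v) (∈-swap⁻ v∈))) (adj-swap u v uv)

  cover-swap : CoverTwo (flip c) → CoverTwo c
  cover-swap (col₁ , col₂ , vs₁ , vs₂ , col₁≢col₂ , t₁ , t₂ , disjoint , covers) =
    col₁ , col₂ , map swap vs₁ , map swap vs₂ , col₁≢col₂ , tree-swap t₁ , tree-swap t₂ ,
    (λ w in₁ in₂ → disjoint (swap w) (∈-swap⁻ in₁) (∈-swap⁻ in₂)) ,
    (λ w → Sum.map ∈-swap⁺ ∈-swap⁺ (covers (swap w)))

-- X and Y lie on the same side (a blue-only a and green-only b would share the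
-- edge ab), and that side is A or, after transposing, B.
coverS2 : ∀ {m n : ℕ} → Fin m → Fin n → (c : Coloring m n) → S2 c → CoverTwo c
coverS2 a₀ b₀ c (sT@((inj₁ a₁ , h₁) , (inj₁ a₃ , h₃)) , ¬S1) =
  Covering.coverA c b₀ h₁ h₃ (λ s → ¬S1 (inj₁ (sT , inj₁ s))) (λ s → ¬S1 (inj₂ (sT , inj₁ s)))
coverS2 a₀ b₀ c (sT@((inj₂ b₁ , h₁) , (inj₂ b₃ , h₃)) , ¬S1) =
  Transpose.cover-swap c
    (Covering.coverA (flip c) a₀ h₁ h₃ (λ s → ¬S1 (inj₁ (sT , inj₂ s))) (λ s → ¬S1 (inj₂ (sT , inj₂ s))))
coverS2 _ _ c (((inj₁ a , h₁) , (inj₂ b , h₃)) , _) = ⊥-elim (blue≢green (trans (sym (h₁ b)) (h₃ a)))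
coverS2 _ _ c (((inj₂ b , h₁) , (inj₁ a , h₃)) , _) = ⊥-elim (blue≢green (trans (sym (h₁ a)) (h₃ b)))

lemma3 : ∀ {m n : ℕ} → 0 < m → 0 < n → (c : Coloring m n) → S2 c →
    (CoverIsoTree c ⊎ CoverTwo c) ×
    ((XYinA c ⊎ XYinB c) → cardX c ⊓ cardY c ≢ 1 → CoverTwo c)
lemma3 m>0 n>0 c s2 = inj₂ cover , λ _ _ → cover
  where
  cover : CoverTwo c
  cover = coverS2 (fromℕ< m>0) (fromℕ< n>0) c s2
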